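{- Let $0<\alpha<1$ be irrational with continued fraction expansion $[0,a_1,a_2,\ldots]$ and convergent denominators $q_i$ (with the convention $q_{ -1}=0$). For every integer $t \ge 0$ and every positive integer $n$, the lazy Ostrowski representation of $n$ has length $t+1$ (i.e., has the form $\sum_{0\le i\le t} d_i q_i$ with $d_t>0$) if and only if $$q_t + q_{t-1} - 1 \leq n \leq q_{t+1} + q_t - 2.$$
   Context: Let $p_i/q_i=[0,a_1,\ldots,a_i]$ be the convergents of $\alpha$, so $q_{ -1}=0$, $q_0=1$, $q_i=a_iq_{i-1}+q_{i-2}$ for $i\ge1$. The lazy Ostrowski representation of a positive integer $n$ is the (unique) expression $n=\sum_{0\le i\le t} d_i q_i$, written $d_t d_{t-1}\cdots d_0$, with $d_t>0$ satisfying: $0 \le d_0 < a_1$; $0 \le d_i \le a_{i+1}$ for $i\ge1$; for $2 \le i \le t$, if $d_i=0$ then $d_{i-1}=a_i$; and if $d_1=0$ (with $t\ge1$) then $d_0=a_1-1$. Its length is $t+1$. -}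

module Defs where

open import Data.Nat using (ℕ; zero; suc; _+_; _*_; _∸_; _≤_; _<_)
open import Relation.Binary.PropositionalEquality using (_≡_)

-- An irrational α ∈ (0,1) is identified with its continued fraction
-- expansion [0, a 1, a 2, ...]: an infinite sequence of positive integers.
-- (a 0 is unused.)
PartialQuotients : (ℕ → ℕ) → Set
PartialQuotients a = ∀ i → 1 ≤ i → 1 ≤ a i

-- Shifted convergent denominators: Q a i = q_{i-1}.
-- Q a 0 = q_{-1} = 0, Q a 1 = q_0 = 1, Q a (i+2) = q_{i+1} = a_{i+1} q_i + q_{i-1}.
Q : (ℕ → ℕ) → ℕ → ℕ
Q a zero = 0
Q a (suc zero) = 1
Q a (suc (suc i)) = a (suc i) * Q a (suc i) + Q a i

q : (ℕ → ℕ) → ℕ → ℕ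
q a i = Q a (suc i)

ostSum : (ℕ → ℕ) → (ℕ → ℕ) → ℕ → ℕ
ostSum a d zero = d 0 * q a 0
ostSum a d (suc t) = ostSum a d t + d (suc t) * q a (suc t)

-- d_t d_{t-1} ... d_0 (only d 0 .. d t are relevant) is a lazy Ostrowski
-- representation of n of length t+1.
record IsLazyOstrowski (a : ℕ → ℕ) (n t : ℕ) (d : ℕ → ℕ) : Set where
  field
    value    : n ≡ ostSum a d t
    lead     : 0 < d t
    digit0   : d 0 < a 1
    digitBd  : ∀ i → 1 ≤ i → i ≤ t → d i ≤ a (suc i)
    lazyCond : ∀ i → 2 ≤ i → i ≤ t → d i ≡ 0 → d (i ∸ 1) ≡ a i
    lazy1    : 1 ≤ t → d 1 ≡ 0 → d 0 ≡ a 1 ∸ 1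

module Submission where

-- Call a digit string d₀ … d_k *valid* if it satisfies all constraints of a
-- lazy Ostrowski representation except d_k > 0; write S for its value.
-- Two facts about valid strings of length k+1 give the theorem:
--   (bounds)    q_k ≤ S + 1 < q_{k+1} + q_k  and  d_k q_k + q_{k-1} ≤ S + 1;
--   (existence) every N with q_k ≤ N < q_{k+1} + q_k equals S + 1 for some
--               valid string.
-- The bounds follow by induction on k; a zero top digit forces the digit
-- below it, which keeps S + 1 ≥ q_k.  Existence follows by induction on k,
-- splitting [q_k, q_{k+1} + q_k) into the part with top digit 0 (where
-- d_{k-1} = a_k is forced and the rest has length k-1) and the lead interval
-- [q_k + q_{k-1}, q_{k+1} + q_k), where dividing N - q_{k-1} by q_k gives the
-- top digit c ∈ [1, a_{k+1}] and a remainder handled at length k.  A lazy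
-- representation of length t+1 is a valid string with d_t ≥ 1, so lemma7 is
-- the bounds together with existence on the lead interval of level t.

open import Defs
open import Data.Nat
  using (ℕ; zero; suc; _+_; _*_; _∸_; _≤_; _<_; z≤n; s≤s; s≤s⁻¹; z<s; _≤?_; NonZero; >-nonZero)
open import Data.Nat.Properties
open import Data.Nat.DivMod using (_/_; _%_; m≡m%n+[m/n]*n; m%n<n; m≥n⇒m/n>0; m<n*o⇒m/o<n)
open import Data.Nat.Tactic.RingSolver using (solve)
open import Data.List using ([]; _∷_)
open import Data.Product using (_×_; ∃; ∃₂; _,_)
open import Data.Sum using (inj₁; inj₂)
open import Function.Bundles using (_⇔_; mk⇔)
open import Relation.Binary.PropositionalEquality
open import Relation.Nullary using (yes; no; contradiction)
open import Data.Empty using (⊥-elim)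
open import Algebra.Properties.CommutativeSemigroup +-commutativeSemigroup using (xy∙z≈xz∙y)

record Valid (a : ℕ → ℕ) (k : ℕ) (d : ℕ → ℕ) : Set where
  field
    digit0   : d 0 < a 1
    digitBd  : ∀ i → 1 ≤ i → i ≤ k → d i ≤ a (suc i)
    lazyCond : ∀ i → 2 ≤ i → i ≤ k → d i ≡ 0 → d (i ∸ 1) ≡ a i
    lazy1    : 1 ≤ k → d 1 ≡ 0 → d 0 ≡ a 1 ∸ 1

open Valid

restrict : ∀ {a k d} → Valid a (suc k) d → Valid a k d
restrict v = record
  { digit0   = digit0 v
  ; digitBd  = λ i 1≤i i≤k → digitBd v i 1≤i (m≤n⇒m≤1+n i≤k)
  ; lazyCond = λ i 2≤i i≤k → lazyCond v i 2≤i (m≤n⇒m≤1+n i≤k)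
  ; lazy1    = λ _ → lazy1 v (s≤s z≤n) }

-- The digit that a zero in position k+1 forces in position k.
Forced : (ℕ → ℕ) → ℕ → ℕ
Forced a zero    = a 1 ∸ 1
Forced a (suc k) = a (suc (suc k))

below-zero-forced : ∀ {a k d} → Valid a (suc k) d → d (suc k) ≡ 0 → d k ≡ Forced a k
below-zero-forced {k = zero}  v = lazy1 v (s≤s z≤n)
below-zero-forced {k = suc k} v = lazyCond v (suc (suc k)) (s≤s (s≤s z≤n)) ≤-refl

q-pos : ∀ {a} → PartialQuotients a → ∀ k → 1 ≤ Q a (suc k)
q-pos pq zero    = s≤s z≤n
q-pos pq (suc k) = ≤-trans (*-mono-≤ (pq (suc k) (s≤s z≤n)) (q-pos pq k)) (m≤m+n _ _)

Q₂≡a₁ : ∀ a → Q a 2 ≡ a 1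
Q₂≡a₁ a = trans (+-identityʳ (a 1 * 1)) (*-identityʳ (a 1))

below-a₁ : ∀ {a N} → N < Q a 2 + Q a 1 → N ≤ a 1
below-a₁ {a} {N} h = m<1+n⇒m≤n (subst (N <_) (trans (+-comm (Q a 2) 1) (cong suc (Q₂≡a₁ a))) h)

sum-upper : ∀ {a k d} → Valid a k d → ostSum a d k + 2 ≤ Q a (suc (suc k)) + Q a (suc k)
sum-upper {a} {zero} {d} v = first-digit (digit0 v)
  where
  first-digit : ∀ {x A} → x < A → x * 1 + 2 ≤ A * 1 + 0 + 1
  first-digit {x} {A} x<A = begin
    x * 1 + 2          ≡⟨ solve (x ∷ []) ⟩
    suc x * 1 + 0 + 1  ≤⟨ +-monoˡ-≤ 1 (+-monoˡ-≤ 0 (*-monoˡ-≤ 1 x<A)) ⟩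
    A * 1 + 0 + 1      ∎
    where open ≤-Reasoning
sum-upper {a} {suc k} {d} v =
  next-digit {Y = Q a (suc (suc k))} {Q a (suc k)} {a (suc (suc k))}
    (sum-upper (restrict v)) (*-monoˡ-≤ (Q a (suc (suc k))) (digitBd v (suc k) (s≤s z≤n) ≤-refl))
  where
  -- with Y = q_{k+1}, Z = q_k and A = a_{k+2}: A Y + Z + Y = q_{k+2} + q_{k+1}
  next-digit : ∀ {S X Y Z A} → S + 2 ≤ Y + Z → X ≤ A * Y → S + X + 2 ≤ A * Y + Z + Y
  next-digit {S} {X} {Y} {Z} {A} h₁ h₂ = begin
    S + X + 2        ≡⟨ solve (S ∷ X ∷ []) ⟩
    S + 2 + X        ≤⟨ +-mono-≤ h₁ h₂ ⟩
    Y + Z + A * Y    ≡⟨ solve (Y ∷ Z ∷ A ∷ []) ⟩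
    A * Y + Z + Y    ∎
    where open ≤-Reasoning

mutual
  sum-lower : ∀ {a k d} → PartialQuotients a → Valid a k d → Q a (suc k) ≤ ostSum a d k + 1
  sum-lower {k = zero} {d} pq v = m≤n+m 1 (d 0 * 1)
  sum-lower {a} {suc k} {d} pq v with d (suc k) in top
  ... | suc c = begin
    Y                                 ≤⟨ m≤m+n Y (c * Y) ⟩
    suc c * Y                         ≤⟨ m≤n+m _ (ostSum a d k) ⟩
    ostSum a d k + suc c * Y          ≤⟨ m≤m+n _ 1 ⟩
    ostSum a d k + suc c * Y + 1      ∎
    where
    open ≤-Reasoning
    Y = Q a (suc (suc k))
  ... | zero = begin
    Q a (suc (suc k))     ≤⟨ forced-lower pq (restrict v) (below-zero-forced v top) ⟩
    ostSum a d k + 1      ≡⟨ cong (_+ 1) (sym (+-identityʳ (ostSum a d k))) ⟩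
    ostSum a d k + 0 + 1  ∎
    where open ≤-Reasoning

  top-lower : ∀ {a k d} → PartialQuotients a → Valid a k d →
              d k * Q a (suc k) + Q a k ≤ ostSum a d k + 1
  top-lower {k = zero} {d} pq v = +-monoʳ-≤ (d 0 * 1) z≤n
  top-lower {a} {suc k} {d} pq v = shift (sum-lower pq (restrict v))
    where
    shift : ∀ {S X Z} → Z ≤ S + 1 → X + Z ≤ S + X + 1
    shift {S} {X} {Z} h = begin
      X + Z          ≤⟨ +-monoʳ-≤ X h ⟩
      X + (S + 1)    ≡⟨ solve (X ∷ S ∷ []) ⟩
      S + X + 1      ∎
      where open ≤-Reasoning

  forced-lower : ∀ {a k d} → PartialQuotients a → Valid a k d → d k ≡ Forced a k →
                 Q a (suc (suc k)) ≤ ostSum a d k + 1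
  forced-lower {a} {zero} {d} pq v forced = ≤-reflexive (begin
    Q a 2              ≡⟨ Q₂≡a₁ a ⟩
    a 1                ≡⟨ sym (m∸n+n≡m (pq 1 (s≤s z≤n))) ⟩
    a 1 ∸ 1 + 1        ≡⟨ cong (_+ 1) (sym forced) ⟩
    d 0 + 1            ≡⟨ cong (_+ 1) (sym (*-identityʳ (d 0))) ⟩
    d 0 * 1 + 1        ∎)
    where open ≡-Reasoning
  forced-lower {a} {suc k} {d} pq v forced =
    subst (λ x → x * Q a (suc (suc k)) + Q a (suc k) ≤ ostSum a d (suc k) + 1) forced (top-lower pq v)

extend : (ℕ → ℕ) → ℕ → ℕ → ℕ → ℕ
extend d k c i with i ≤? k
... | yes _ = d i
... | no  _ = c

extend-below : ∀ d k c {i} → i ≤ k → extend d k c i ≡ d i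
extend-below d k c {i} i≤k with i ≤? k
... | yes _   = refl
... | no  i≰k = contradiction i≤k i≰k

extend-top : ∀ d k c → extend d k c (suc k) ≡ c
extend-top d k c with suc k ≤? k
... | yes k+1≤k = ⊥-elim (1+n≰n k+1≤k)
... | no  _     = refl

ostSum-cong : ∀ a {d e} k → (∀ i → i ≤ k → d i ≡ e i) → ostSum a d k ≡ ostSum a e k
ostSum-cong a zero    d≗e = cong (_* q a 0) (d≗e 0 z≤n)
ostSum-cong a (suc k) d≗e =
  cong₂ _+_ (ostSum-cong a k (λ i i≤k → d≗e i (m≤n⇒m≤1+n i≤k))) (cong (_* q a (suc k)) (d≗e (suc k) ≤-refl))

extend-sum : ∀ a d k c → ostSum a (extend d k c) (suc k) ≡ ostSum a d k + c * Q a (suc (suc k))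
extend-sum a d k c =
  cong₂ _+_ (ostSum-cong a k (λ i → extend-below d k c)) (cong (_* Q a (suc (suc k))) (extend-top d k c))

extend-lazy-top : ∀ {a} d k c → 2 ≤ suc k → (c ≡ 0 → d k ≡ Forced a k) →
                  extend d k c (suc k) ≡ 0 → extend d k c k ≡ a (suc k)
extend-lazy-top d zero    c (s≤s ())
extend-lazy-top d (suc k) c _ lazy rewrite extend-top d (suc k) c | extend-below d (suc k) c ≤-refl = lazy

extend-lazy1 : ∀ {a k d c} → Valid a k d → (c ≡ 0 → d k ≡ Forced a k) →
               extend d k c 1 ≡ 0 → extend d k c 0 ≡ a 1 ∸ 1
extend-lazy1 {k = zero} {d} {c} v lazy rewrite extend-top d 0 c | extend-below d 0 c z≤n = lazy
extend-lazy1 {k = suc k} {d} {c} v lazy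
  rewrite extend-below d (suc k) c (s≤s z≤n) | extend-below d (suc k) c z≤n = lazy1 v (s≤s z≤n)

extend-valid : ∀ {a k d c} → Valid a k d → c ≤ a (suc (suc k)) → (c ≡ 0 → d k ≡ Forced a k) →
               Valid a (suc k) (extend d k c)
extend-valid {a} {k} {d} {c} v c≤a lazy = record
  { digit0   = subst (_< a 1) (sym (extend-below d k c z≤n)) (digit0 v)
  ; digitBd  = bound
  ; lazyCond = lazyAt
  ; lazy1    = λ _ → extend-lazy1 v lazy }
  where
  bound : ∀ i → 1 ≤ i → i ≤ suc k → extend d k c i ≤ a (suc i)
  bound i 1≤i i≤k+1 with m≤n⇒m<n∨m≡n i≤k+1
  ... | inj₁ i<k+1 rewrite extend-below d k c (s≤s⁻¹ i<k+1) = digitBd v i 1≤i (s≤s⁻¹ i<k+1)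
  ... | inj₂ refl  rewrite extend-top d k c = c≤a

  lazyAt : ∀ i → 2 ≤ i → i ≤ suc k → extend d k c i ≡ 0 → extend d k c (i ∸ 1) ≡ a i
  lazyAt i 2≤i i≤k+1 with m≤n⇒m<n∨m≡n i≤k+1
  ... | inj₁ i<k+1
    rewrite extend-below d k c (s≤s⁻¹ i<k+1) | extend-below d k c (≤-trans (m∸n≤m i 1) (s≤s⁻¹ i<k+1))
    = lazyCond v i 2≤i (s≤s⁻¹ i<k+1)
  ... | inj₂ refl = extend-lazy-top d k c 2≤i lazy

divide : ∀ {x Y A} .{{_ : NonZero Y}} → Y ≤ x → x < suc A * Y →
         ∃₂ λ c r → 1 ≤ c × c ≤ A × r < Y × x ≡ c * Y + r
divide {x} {Y} Y≤x x<[A+1]Y =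
  x / Y , x % Y , m≥n⇒m/n>0 Y≤x , s≤s⁻¹ (m<n*o⇒m/o<n x<[A+1]Y) , m%n<n x Y ,
  trans (m≡m%n+[m/n]*n x Y) (+-comm (x % Y) _)

-- The lead interval of level k+1, with Y = q_{k+1}, Z = q_k, A = a_{k+2}:
-- N ∈ [Y + Z, A Y + Z + Y) is N′ + c Y with c ∈ [1, A] and N′ ∈ [Z, Y + Z).
lead-split : ∀ {N Y Z A} .{{_ : NonZero Y}} → Y + Z ≤ N → N < A * Y + Z + Y →
             ∃₂ λ c N′ → 1 ≤ c × c ≤ A × Z ≤ N′ × N′ < Y + Z × N ≡ N′ + c * Y
lead-split {N} {Y} {Z} {A} lo hi = assemble (divide (m+n≤o⇒m≤o∸n Y lo) quotient-bound)
  where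
  Z≤N : Z ≤ N
  Z≤N = ≤-trans (m≤n+m Z Y) lo

  regroup : A * Y + Z + Y ≡ Z + suc A * Y
  regroup = solve (A ∷ Y ∷ Z ∷ [])

  hi′ : N < Z + suc A * Y
  hi′ = subst (N <_) regroup hi

  quotient-bound : N ∸ Z < suc A * Y
  quotient-bound = subst (N ∸ Z <_) (m+n∸m≡n Z (suc A * Y)) (∸-monoˡ-< hi′ Z≤N)

  assemble : (∃₂ λ c r → 1 ≤ c × c ≤ A × r < Y × N ∸ Z ≡ c * Y + r) →
             ∃₂ λ c N′ → 1 ≤ c × c ≤ A × Z ≤ N′ × N′ < Y + Z × N ≡ N′ + c * Y
  assemble (c , r , 1≤c , c≤A , r<Y , N-Z≡) = c , r + Z , 1≤c , c≤A , m≤n+m Z r , +-monoˡ-< Z r<Y , (begin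
    N              ≡⟨ sym (m∸n+n≡m Z≤N) ⟩
    N ∸ Z + Z      ≡⟨ cong (_+ Z) N-Z≡ ⟩
    c * Y + r + Z  ≡⟨ solve (c ∷ Y ∷ r ∷ Z ∷ []) ⟩
    r + Z + c * Y  ∎)
    where open ≡-Reasoning

-- The zero-top part of level k+2, with Y = q_{k+1}, Z = q_k, A = a_{k+2}:
-- N ∈ [A Y + Z, A Y + Z + Y) is N′ + A Y with N′ ∈ [Z, Y + Z).
zero-split : ∀ {N Y Z A} → A * Y + Z ≤ N → N < A * Y + Z + Y →
             ∃ λ N′ → Z ≤ N′ × N′ < Y + Z × N ≡ N′ + A * Y
zero-split {N} {Y} {Z} {A} lo hi = N ∸ A * Y , lower , upper , sym (m∸n+n≡m AY≤N)
  where
  AY≤N : A * Y ≤ N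
  AY≤N = ≤-trans (m≤m+n (A * Y) Z) lo

  lower : Z ≤ N ∸ A * Y
  lower = m+n≤o⇒m≤o∸n Z (subst (_≤ N) (+-comm (A * Y) Z) lo)

  upper : N ∸ A * Y < Y + Z
  upper = subst (N ∸ A * Y <_) (m+n∸m≡n (A * Y) (Y + Z)) (∸-monoˡ-< hi′ AY≤N)
    where
    regroup : A * Y + Z + Y ≡ A * Y + (Y + Z)
    regroup = solve (A ∷ Y ∷ Z ∷ [])

    hi′ : N < A * Y + (Y + Z)
    hi′ = subst (N <_) regroup hi

record Rep (a : ℕ → ℕ) (k c N : ℕ) : Set where
  constructor rep
  field
    digits : ℕ → ℕ
    valid  : Valid a k digits
    top    : digits k ≡ c
    value  : N ≡ ostSum a digits k + 1

single : ∀ {a x} → x < a 1 → Rep a 0 x (x + 1)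
single {a} {x} x<a₁ = rep (λ _ → x) valid refl (cong (_+ 1) (sym (*-identityʳ x)))
  where
  valid : Valid a 0 (λ _ → x)
  valid = record
    { digit0   = x<a₁
    ; digitBd  = λ { _ (s≤s z≤n) () }
    ; lazyCond = λ { _ (s≤s (s≤s z≤n)) () }
    ; lazy1    = λ () }

append : ∀ {a k c N c′} → Rep a k c N → c′ ≤ a (suc (suc k)) → (c′ ≡ 0 → c ≡ Forced a k) →
         Rep a (suc k) c′ (N + c′ * Q a (suc (suc k)))
append {a} {k} {c} {N} {c′} (rep d v top val) c′≤a lazy =
  rep (extend d k c′) (extend-valid v c′≤a (λ c′≡0 → trans top (lazy c′≡0))) (extend-top d k c′) (begin
    N + c′ * Y                              ≡⟨ cong (_+ c′ * Y) val ⟩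
    ostSum a d k + 1 + c′ * Y               ≡⟨ xy∙z≈xz∙y (ostSum a d k) 1 (c′ * Y) ⟩
    ostSum a d k + c′ * Y + 1               ≡⟨ cong (_+ 1) (sym (extend-sum a d k c′)) ⟩
    ostSum a (extend d k c′) (suc k) + 1    ∎)
  where
  open ≡-Reasoning
  Y = Q a (suc (suc k))

append-lead : ∀ {a k c N c′} → Rep a k c N → 1 ≤ c′ → c′ ≤ a (suc (suc k)) →
              Rep a (suc k) c′ (N + c′ * Q a (suc (suc k)))
append-lead r (s≤s z≤n) c′≤a = append r c′≤a (λ ())

Representable : (ℕ → ℕ) → ℕ → Set
Representable a k = ∀ N → Q a (suc k) ≤ N → N < Q a (suc (suc k)) + Q a (suc k) → ∃ λ c → Rep a k c N

representable₀ : ∀ {a} → Representable a 0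
representable₀ {a} (suc x) _ hi = x , subst (Rep a 0 x) (+-comm x 1) (single (below-a₁ {a} hi))

lead-step : ∀ {a} → PartialQuotients a → ∀ k → Representable a k → ∀ N →
            Q a (suc (suc k)) + Q a (suc k) ≤ N → N < Q a (suc (suc (suc k))) + Q a (suc (suc k)) →
            ∃ λ c → 1 ≤ c × Rep a (suc k) c N
lead-step {a} pq k rep-k N lo hi
  with lead-split {A = a (suc (suc k))} {{>-nonZero (q-pos pq (suc k))}} lo hi
... | c , N′ , 1≤c , c≤A , Z≤N′ , N′<Y+Z , N≡ with rep-k N′ Z≤N′ N′<Y+Z
... | _ , r = c , 1≤c , subst (Rep a (suc k) c) (sym N≡) (append-lead r 1≤c c≤A)

-- Level 1, top digit 0: N = q₁ = a₁ is represented by d₀ = a₁ - 1, d₁ = 0.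
zero-top₁ : ∀ {a} → PartialQuotients a → ∀ N → Q a 2 ≤ N → N < Q a 2 + Q a 1 → Rep a 1 0 N
zero-top₁ {a} pq N lo hi = subst (Rep a 1 0) value (append (single (∸-monoʳ-< z<s a₁≥1)) z≤n (λ _ → refl))
  where
  open ≡-Reasoning
  a₁≥1 : 1 ≤ a 1
  a₁≥1 = pq 1 (s≤s z≤n)

  value : a 1 ∸ 1 + 1 + 0 * Q a 2 ≡ N
  value = begin
    a 1 ∸ 1 + 1 + 0   ≡⟨ +-identityʳ (a 1 ∸ 1 + 1) ⟩
    a 1 ∸ 1 + 1       ≡⟨ m∸n+n≡m a₁≥1 ⟩
    a 1               ≡⟨ ≤-antisym (subst (_≤ N) (Q₂≡a₁ a) lo) (below-a₁ {a} hi) ⟩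
    N                 ∎

-- Level k+2, top digit 0: the digit a_{k+2} below it is forced, and the
-- rest N - a_{k+2} q_{k+1} lies in the interval of level k.
zero-top : ∀ {a} → PartialQuotients a → ∀ k → Representable a k → ∀ N →
           Q a (suc (suc (suc k))) ≤ N → N < Q a (suc (suc (suc k))) + Q a (suc (suc k)) →
           Rep a (suc (suc k)) 0 N
zero-top {a} pq k rep-k N lo hi with zero-split {A = a (suc (suc k))} lo hi
... | N′ , Z≤N′ , N′<Y+Z , N≡ with rep-k N′ Z≤N′ N′<Y+Z
... | _ , r = subst (Rep a (suc (suc k)) 0) (sym (trans N≡ (sym (+-identityʳ _))))
                (append (append-lead r (pq (suc (suc k)) (s≤s z≤n)) ≤-refl) z≤n (λ _ → refl))

-- Every level is representable: split off the lead interval, the rest has top digit 0.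
representable : ∀ {a} → PartialQuotients a → ∀ k → Representable a k
representable pq zero = representable₀
representable {a} pq (suc k) N lo hi with Q a (suc (suc k)) + Q a (suc k) ≤? N
... | yes in-lead = let (c , _ , r) = lead-step pq k (representable pq k) N in-lead hi in c , r
representable pq (suc zero)    N lo hi | no below-lead = 0 , zero-top₁ pq N lo (≰⇒> below-lead)
representable pq (suc (suc k)) N lo hi | no below-lead =
  0 , zero-top pq k (representable pq k) N lo (≰⇒> below-lead)

lazy-valid : ∀ {a n t d} → IsLazyOstrowski a n t d → Valid a t d
lazy-valid L = record
  { digit0 = IsLazyOstrowski.digit0 L ; digitBd = IsLazyOstrowski.digitBd L
  ; lazyCond = IsLazyOstrowski.lazyCond L ; lazy1 = IsLazyOstrowski.lazy1 L }

lazy-from-rep : ∀ {a t c n} → 1 ≤ c → Rep a t c (n + 1) → ∃ λ d → IsLazyOstrowski a n t d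
lazy-from-rep 1≤c (rep d v top val) = d , record
  { value = +-cancelʳ-≡ 1 _ _ val ; lead = subst (1 ≤_) (sym top) 1≤c
  ; digit0 = digit0 v ; digitBd = digitBd v ; lazyCond = lazyCond v ; lazy1 = lazy1 v }

lazy-bounds : ∀ {a t n d} → PartialQuotients a → IsLazyOstrowski a n t d →
              (Q a (suc t) + Q a t ≤ n + 1) × (n + 2 ≤ Q a (suc (suc t)) + Q a (suc t))
lazy-bounds {a} {t} {n} {d} pq L = lower , subst (λ m → m + 2 ≤ _) (sym value) (sum-upper (lazy-valid L))
  where
  open IsLazyOstrowski L using (value; lead)
  open ≤-Reasoning
  lower : Q a (suc t) + Q a t ≤ n + 1
  lower = begin
    Q a (suc t) + Q a t           ≤⟨ +-monoˡ-≤ (Q a t) (m≤n*m (Q a (suc t)) (d t) {{>-nonZero lead}}) ⟩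
    d t * Q a (suc t) + Q a t     ≤⟨ top-lower pq (lazy-valid L) ⟩
    ostSum a d t + 1              ≡⟨ cong (_+ 1) (sym value) ⟩
    n + 1                         ∎

lazy-exists : ∀ {a} → PartialQuotients a → ∀ t n → 1 ≤ n →
              Q a (suc t) + Q a t ≤ n + 1 → n + 1 < Q a (suc (suc t)) + Q a (suc t) →
              ∃ λ d → IsLazyOstrowski a n t d
lazy-exists {a} pq zero n 1≤n _ hi =
  lazy-from-rep 1≤n (single (subst (_≤ a 1) (+-comm n 1) (below-a₁ {a} hi)))
lazy-exists pq (suc k) n _ lo hi =
  let (c , 1≤c , r) = lead-step pq k (representable pq k) (n + 1) lo hi in lazy-from-rep 1≤c r

lemma7 : (a : ℕ → ℕ) → PartialQuotients a → (t n : ℕ) → 1 ≤ n →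
    (∃ (λ d → IsLazyOstrowski a n t d)) ⇔
    ((Q a (suc t) + Q a t ≤ n + 1) × (n + 2 ≤ Q a (suc (suc t)) + Q a (suc t)))
lemma7 a pq t n 1≤n = mk⇔
  (λ (_ , L) → lazy-bounds pq L)
  (λ (lo , hi) → lazy-exists pq t n 1≤n lo (subst (_≤ Q a (suc (suc t)) + Q a (suc t)) (+-suc n 1) hi))
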